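{- Let $m\ge 0$ be an integer, $k=4m+3$, and $f(x,z)=\lfloor\frac{x+z}{k}\rfloor$ for non-negative integers $x,z$. Let $x,y,z$ be non-negative integers with $x\oplus y\oplus z\neq 0$ and $y\le f(x,z)$. Then at least one of the following holds: (1) $u\oplus y\oplus z=0$ for some integer $0\le u<x$; (2) $u\oplus v\oplus z=0$ for some integers $0\le u<x$, $0\le v<y$ with $v=f(u,z)$; (3) $x\oplus v\oplus z=0$ for some integer $0\le v<y$; (4) $x\oplus y\oplus w=0$ for some integer $0\le w<z$ with $y\le f(x,w)$; (5) $x\oplus v\oplus w=0$ for some integers $0\le v<y$, $0\le w<z$ with $v=f(x,w)$.
   Context: $\oplus$ denotes nim-sum: the bitwise XOR of binary expansions of non-negative integers. -}

module Defs where

open import Data.Nat using (ℕ; zero; suc; _+_; _*_; _/_; _%_)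
open import Data.Nat.Induction using (<-wellFounded)
open import Data.Nat.DivMod using (m/n<m)
open import Data.Nat using (_<_; s≤s; z≤n)
open import Induction.WellFounded using (Acc; acc)

bitxor : ℕ → ℕ → ℕ
bitxor 0 0 = 0
bitxor 0 1 = 1
bitxor 1 0 = 1
bitxor 1 1 = 0
bitxor _ _ = 0

xorAcc : (a : ℕ) → Acc _<_ a → ℕ → ℕ
xorAcc zero _ b = b
xorAcc (suc a) (acc rs) b =
  bitxor (suc a % 2) (b % 2)
    + 2 * xorAcc (suc a / 2) (rs (m/n<m (suc a) 2 (s≤s (s≤s z≤n)))) (b / 2)

infixl 6 _⊕_
_⊕_ : ℕ → ℕ → ℕ
a ⊕ b = xorAcc a (<-wellFounded a) b

-- k = 4m+3, written as 3 + 4m so it is syntactically nonzero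
k : ℕ → ℕ
k m = suc (suc (suc (4 * m)))

f : (m : ℕ) → ℕ → ℕ → ℕ
f m x z = (x + z) / k m

-- If x ⊕ y ⊕ z ≠ 0, the usual nim argument lowers one of the three numbers
-- to the nim-sum of the other two. Lowering x or y gives (1) or (3).
-- Lowering z to w = x ⊕ y gives (4) unless y > f(x, w), i.e.
-- x + (x ⊕ y) < k y. Then some v < y is a fixed point, ⌊(x + (x ⊕ v))/k⌋ = v,
-- and w = x ⊕ v gives (5): w < z because f is monotone and y ≤ f(x, z).
-- The fixed point is found by induction on the binary length of y: since
-- x + (x ⊕ 2v) and x + (x ⊕ (2v+1)) are 2(x mod 2 + g) and 2g + 1 with
-- g = ⌊x/2⌋ + (⌊x/2⌋ ⊕ v), a fixed point for ⌊x/2⌋ at v lifts to one for x at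
-- 2v or 2v + 1, parity deciding between them.
module Submission where

open import Defs
open import Data.Nat using (ℕ; zero; suc; _+_; _*_; _/_; _%_; _<_; _≤_; z≤n; s≤s; s≤s⁻¹;
  NonZero; ≢-nonZero; _<?_; _≤?_; _≟_)
open import Data.Nat.Properties
open import Data.Nat.DivMod
open import Data.Nat.Induction using (<-rec; <-wellFounded)
open import Data.Nat.Tactic.RingSolver using (solve-∀)
open import Data.Product using (Σ; _×_; _,_; ∃-syntax)
open import Data.Sum using (_⊎_; inj₁; inj₂) renaming (map to ⊎-map)
open import Induction.WellFounded using (Acc; acc)
open import Relation.Binary.Definitions using (tri<; tri≈; tri>)
open import Relation.Binary.PropositionalEquality
open import Relation.Nullary using (¬_; yes; no; contradiction)

IsQuotient : ℕ → ℕ → ℕ → Set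
IsQuotient n d q = q * d ≤ n × n < suc q * d

m*n≤o⇒m≤o/n : ∀ {m n o} .{{_ : NonZero n}} → m * n ≤ o → m ≤ o / n
m*n≤o⇒m≤o/n {m} {n} {o} le = subst (_≤ o / n) (m*n/n≡m m n) (/-monoˡ-≤ n le)

IsQuotient⇒/≡ : ∀ {n d q} .{{_ : NonZero d}} → IsQuotient n d q → n / d ≡ q
IsQuotient⇒/≡ (lo , hi) = ≤-antisym (s≤s⁻¹ (m<n*o⇒m/o<n hi)) (m*n≤o⇒m≤o/n lo)

halving-induction : ∀ {ℓ} (P : ℕ → Set ℓ) → P 0 →
  (∀ n .{{_ : NonZero n}} → P (n / 2) → P n) → ∀ n → P n
halving-induction P base step = <-rec P go
  where
  go : ∀ n → (∀ {m} → m < n → P m) → P n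
  go zero    _  = base
  go (suc n) ih = step (suc n) (ih (m/n<m (suc n) 2 (s≤s (s≤s z≤n))))

Bit : ℕ → Set
Bit r = r ≡ 0 ⊎ r ≡ 1

%2-bit : ∀ a → Bit (a % 2)
%2-bit a with a % 2 | m%n<n a 2
... | 0           | _                 = inj₁ refl
... | 1           | _                 = inj₂ refl
... | suc (suc _) | s≤s (s≤s ())

[r+q*2]%2≡r : ∀ {r} q → Bit r → (r + q * 2) % 2 ≡ r
[r+q*2]%2≡r q (inj₁ refl) = [m+kn]%n≡m%n 0 q 2
[r+q*2]%2≡r q (inj₂ refl) = [m+kn]%n≡m%n 1 q 2

[r+q*2]/2≡q : ∀ {r} q → Bit r → (r + q * 2) / 2 ≡ q
[r+q*2]/2≡q {r} q bit = IsQuotient⇒/≡ (m≤n+m (q * 2) r , +-monoˡ-< (q * 2) (bit<2 bit))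
  where
  bit<2 : ∀ {r} → Bit r → r < 2
  bit<2 (inj₁ refl) = s≤s z≤n
  bit<2 (inj₂ refl) = s≤s (s≤s z≤n)

bits-injective : ∀ {a b} → a % 2 ≡ b % 2 → a / 2 ≡ b / 2 → a ≡ b
bits-injective {a} {b} r q = begin
  a                   ≡⟨ m≡m%n+[m/n]*n a 2 ⟩
  a % 2 + a / 2 * 2   ≡⟨ cong₂ (λ r q → r + q * 2) r q ⟩
  b % 2 + b / 2 * 2   ≡⟨ m≡m%n+[m/n]*n b 2 ⟨
  b                   ∎
  where open ≡-Reasoning

bitxor-bit : ∀ {r s} → Bit r → Bit s → Bit (bitxor r s)
bitxor-bit (inj₁ refl) (inj₁ refl) = inj₁ refl
bitxor-bit (inj₁ refl) (inj₂ refl) = inj₂ refl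
bitxor-bit (inj₂ refl) (inj₁ refl) = inj₂ refl
bitxor-bit (inj₂ refl) (inj₂ refl) = inj₁ refl

bitxor-identityˡ : ∀ {r} → Bit r → bitxor 0 r ≡ r
bitxor-identityˡ (inj₁ refl) = refl
bitxor-identityˡ (inj₂ refl) = refl

bitxor-identityʳ : ∀ {r} → Bit r → bitxor r 0 ≡ r
bitxor-identityʳ (inj₁ refl) = refl
bitxor-identityʳ (inj₂ refl) = refl

bitxor-self : ∀ {r} → Bit r → bitxor r r ≡ 0
bitxor-self (inj₁ refl) = refl
bitxor-self (inj₂ refl) = refl

bitxor-comm : ∀ {r s} → Bit r → Bit s → bitxor r s ≡ bitxor s r
bitxor-comm (inj₁ refl) (inj₁ refl) = refl
bitxor-comm (inj₁ refl) (inj₂ refl) = refl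
bitxor-comm (inj₂ refl) (inj₁ refl) = refl
bitxor-comm (inj₂ refl) (inj₂ refl) = refl

bitxor-assoc : ∀ {r s t} → Bit r → Bit s → Bit t →
  bitxor (bitxor r s) t ≡ bitxor r (bitxor s t)
bitxor-assoc (inj₁ refl) (inj₁ refl) (inj₁ refl) = refl
bitxor-assoc (inj₁ refl) (inj₁ refl) (inj₂ refl) = refl
bitxor-assoc (inj₁ refl) (inj₂ refl) (inj₁ refl) = refl
bitxor-assoc (inj₁ refl) (inj₂ refl) (inj₂ refl) = refl
bitxor-assoc (inj₂ refl) (inj₁ refl) (inj₁ refl) = refl
bitxor-assoc (inj₂ refl) (inj₁ refl) (inj₂ refl) = refl
bitxor-assoc (inj₂ refl) (inj₂ refl) (inj₁ refl) = refl
bitxor-assoc (inj₂ refl) (inj₂ refl) (inj₂ refl) = refl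

xorAcc-irrelevant : ∀ a (p q : Acc _<_ a) b → xorAcc a p b ≡ xorAcc a q b
xorAcc-irrelevant zero    _        _         b = refl
xorAcc-irrelevant (suc a) (acc rs) (acc rs′) b =
  cong (λ t → bitxor (suc a % 2) (b % 2) + 2 * t)
    (xorAcc-irrelevant _ (rs half<) (rs′ half<) (b / 2))
  where half< = m/n<m (suc a) 2 (s≤s (s≤s z≤n))

⊕-unfold : ∀ a b → a ⊕ b ≡ bitxor (a % 2) (b % 2) + (a / 2 ⊕ b / 2) * 2
⊕-unfold a b = unfold a (<-wellFounded a)
  where
  unfold : ∀ a (p : Acc _<_ a) → xorAcc a p b ≡ bitxor (a % 2) (b % 2) + (a / 2 ⊕ b / 2) * 2
  unfold zero    _        =
    trans (m≡m%n+[m/n]*n b 2) (cong (_+ b / 2 * 2) (sym (bitxor-identityˡ (%2-bit b))))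
  unfold (suc a) (acc rs) = cong (bitxor (suc a % 2) (b % 2) +_)
    (trans (*-comm 2 (xorAcc (suc a / 2) (rs half<) (b / 2)))
      (cong (_* 2) (xorAcc-irrelevant _ (rs half<) (<-wellFounded (suc a / 2)) (b / 2))))
    where half< = m/n<m (suc a) 2 (s≤s (s≤s z≤n))

⊕-%2 : ∀ a b → (a ⊕ b) % 2 ≡ bitxor (a % 2) (b % 2)
⊕-%2 a b = trans (cong (_% 2) (⊕-unfold a b))
  ([r+q*2]%2≡r (a / 2 ⊕ b / 2) (bitxor-bit (%2-bit a) (%2-bit b)))

⊕-/2 : ∀ a b → (a ⊕ b) / 2 ≡ a / 2 ⊕ b / 2
⊕-/2 a b = trans (cong (_/ 2) (⊕-unfold a b))
  ([r+q*2]/2≡q (a / 2 ⊕ b / 2) (bitxor-bit (%2-bit a) (%2-bit b)))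

⊕-identityʳ : ∀ a → a ⊕ 0 ≡ a
⊕-identityʳ = halving-induction _ refl λ a ih →
  bits-injective (trans (⊕-%2 a 0) (bitxor-identityʳ (%2-bit a))) (trans (⊕-/2 a 0) ih)

⊕-self : ∀ a → a ⊕ a ≡ 0
⊕-self = halving-induction _ refl λ a ih →
  bits-injective (trans (⊕-%2 a a) (bitxor-self (%2-bit a))) (trans (⊕-/2 a a) ih)

⊕-comm : ∀ a b → a ⊕ b ≡ b ⊕ a
⊕-comm = halving-induction _ (λ b → sym (⊕-identityʳ b)) λ a ih b → bits-injective
  (trans (⊕-%2 a b) (trans (bitxor-comm (%2-bit a) (%2-bit b)) (sym (⊕-%2 b a))))
  (trans (⊕-/2 a b) (trans (ih (b / 2)) (sym (⊕-/2 b a))))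

⊕-assoc : ∀ a b c → a ⊕ b ⊕ c ≡ a ⊕ (b ⊕ c)
⊕-assoc = halving-induction _ (λ _ _ → refl) λ a ih b c → bits-injective
  (begin
    (a ⊕ b ⊕ c) % 2                         ≡⟨ ⊕-%2 (a ⊕ b) c ⟩
    bitxor ((a ⊕ b) % 2) (c % 2)            ≡⟨ cong (λ t → bitxor t (c % 2)) (⊕-%2 a b) ⟩
    bitxor (bitxor (a % 2) (b % 2)) (c % 2) ≡⟨ bitxor-assoc (%2-bit a) (%2-bit b) (%2-bit c) ⟩
    bitxor (a % 2) (bitxor (b % 2) (c % 2)) ≡⟨ cong (bitxor (a % 2)) (⊕-%2 b c) ⟨
    bitxor (a % 2) ((b ⊕ c) % 2)            ≡⟨ ⊕-%2 a (b ⊕ c) ⟨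
    (a ⊕ (b ⊕ c)) % 2                       ∎)
  (begin
    (a ⊕ b ⊕ c) / 2                         ≡⟨ ⊕-/2 (a ⊕ b) c ⟩
    (a ⊕ b) / 2 ⊕ c / 2                     ≡⟨ cong (_⊕ c / 2) (⊕-/2 a b) ⟩
    a / 2 ⊕ b / 2 ⊕ c / 2                   ≡⟨ ih (b / 2) (c / 2) ⟩
    a / 2 ⊕ (b / 2 ⊕ c / 2)                 ≡⟨ cong (a / 2 ⊕_) (⊕-/2 b c) ⟨
    a / 2 ⊕ (b ⊕ c) / 2                     ≡⟨ ⊕-/2 a (b ⊕ c) ⟨
    (a ⊕ (b ⊕ c)) / 2                       ∎)
  where open ≡-Reasoning

⊕≡0⇒≡ : ∀ {a b} → a ⊕ b ≡ 0 → a ≡ b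
⊕≡0⇒≡ {a} {b} e = begin
  a               ≡⟨ ⊕-identityʳ a ⟨
  a ⊕ 0           ≡⟨ cong (a ⊕_) (⊕-self b) ⟨
  a ⊕ (b ⊕ b)     ≡⟨ ⊕-assoc a b b ⟨
  a ⊕ b ⊕ b       ≡⟨ cong (_⊕ b) e ⟩
  b               ∎
  where open ≡-Reasoning

⊕-rotate : ∀ a b c → a ⊕ b ⊕ c ≡ b ⊕ c ⊕ a
⊕-rotate a b c = trans (⊕-assoc a b c) (⊕-comm a (b ⊕ c))

⊕-swapʳ : ∀ a b c → a ⊕ b ⊕ c ≡ a ⊕ c ⊕ b
⊕-swapʳ a b c =
  trans (⊕-assoc a b c) (trans (cong (a ⊕_) (⊕-comm b c)) (sym (⊕-assoc a c b)))

bitxor≡1 : ∀ {p q r} → Bit p → Bit q → Bit r → bitxor (bitxor p q) r ≡ 1 →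
  (p ≡ 1 × bitxor q r ≡ 0) ⊎ (q ≡ 1 × bitxor p r ≡ 0) ⊎ (r ≡ 1 × bitxor p q ≡ 0)
bitxor≡1 (inj₁ refl) (inj₁ refl) (inj₁ refl) ()
bitxor≡1 (inj₁ refl) (inj₁ refl) (inj₂ refl) _ = inj₂ (inj₂ (refl , refl))
bitxor≡1 (inj₁ refl) (inj₂ refl) (inj₁ refl) _ = inj₂ (inj₁ (refl , refl))
bitxor≡1 (inj₁ refl) (inj₂ refl) (inj₂ refl) ()
bitxor≡1 (inj₂ refl) (inj₁ refl) (inj₁ refl) _ = inj₁ (refl , refl)
bitxor≡1 (inj₂ refl) (inj₁ refl) (inj₂ refl) ()
bitxor≡1 (inj₂ refl) (inj₂ refl) (inj₁ refl) ()
bitxor≡1 (inj₂ refl) (inj₂ refl) (inj₂ refl) _ = inj₁ (refl , refl)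

m/2<n/2⇒m<n : ∀ {m n} → m / 2 < n / 2 → m < n
m/2<n/2⇒m<n {m} {n} lt with m <? n
... | yes m<n = m<n
... | no  m≮n = contradiction (/-monoˡ-≤ 2 (≮⇒≥ m≮n)) (<⇒≱ lt)

even<odd-same-half : ∀ {m n} → m % 2 ≡ 0 → n % 2 ≡ 1 → m / 2 ≡ n / 2 → m < n
even<odd-same-half {m} {n} m₀ n₀ h = subst₂ _<_ (sym m≡) (sym n≡) (n<1+n (n / 2 * 2))
  where
  m≡ : m ≡ n / 2 * 2
  m≡ = trans (m≡m%n+[m/n]*n m 2) (cong₂ (λ r q → r + q * 2) m₀ h)
  n≡ : n ≡ suc (n / 2 * 2)
  n≡ = trans (m≡m%n+[m/n]*n n 2) (cong (_+ n / 2 * 2) n₀)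

NimMove : ℕ → ℕ → ℕ → Set
NimMove x y z = y ⊕ z < x ⊎ x ⊕ z < y ⊎ x ⊕ y < z

nim-move-lowest-bit : ∀ x y z → x ⊕ y ⊕ z ≢ 0 → x / 2 ⊕ y / 2 ⊕ z / 2 ≡ 0 →
  NimMove x y z
nim-move-lowest-bit x y z ne e = ⊎-map move-x (⊎-map move-y move-z)
  (bitxor≡1 (%2-bit x) (%2-bit y) (%2-bit z) s₀≡1)
  where
  s = x ⊕ y ⊕ z
  s₀ : s % 2 ≡ bitxor (bitxor (x % 2) (y % 2)) (z % 2)
  s₀ = trans (⊕-%2 (x ⊕ y) z) (cong (λ t → bitxor t (z % 2)) (⊕-%2 x y))
  s/2≡0 : s / 2 ≡ 0
  s/2≡0 = trans (⊕-/2 (x ⊕ y) z) (trans (cong (_⊕ z / 2) (⊕-/2 x y)) e)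
  s₀≡1 : bitxor (bitxor (x % 2) (y % 2)) (z % 2) ≡ 1
  s₀≡1 with %2-bit s
  ... | inj₁ s₀≡0 = contradiction (bits-injective {s} {0} s₀≡0 s/2≡0) ne
  ... | inj₂ s₀≡1 = trans (sym s₀) s₀≡1
  move-x : x % 2 ≡ 1 × bitxor (y % 2) (z % 2) ≡ 0 → y ⊕ z < x
  move-x (x₀ , yz₀) = even<odd-same-half (trans (⊕-%2 y z) yz₀) x₀
    (trans (⊕-/2 y z) (⊕≡0⇒≡ (trans (sym (⊕-rotate (x / 2) (y / 2) (z / 2))) e)))
  move-y : y % 2 ≡ 1 × bitxor (x % 2) (z % 2) ≡ 0 → x ⊕ z < y
  move-y (y₀ , xz₀) = even<odd-same-half (trans (⊕-%2 x z) xz₀) y₀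
    (trans (⊕-/2 x z) (⊕≡0⇒≡ (trans (sym (⊕-swapʳ (x / 2) (y / 2) (z / 2))) e)))
  move-z : z % 2 ≡ 1 × bitxor (x % 2) (y % 2) ≡ 0 → x ⊕ y < z
  move-z (z₀ , xy₀) = even<odd-same-half (trans (⊕-%2 x y) xy₀) z₀
    (trans (⊕-/2 x y) (⊕≡0⇒≡ e))

nim-move-halves : ∀ x y z → NimMove (x / 2) (y / 2) (z / 2) → NimMove x y z
nim-move-halves x y z = ⊎-map (lift (⊕-/2 y z)) (⊎-map (lift (⊕-/2 x z)) (lift (⊕-/2 x y)))
  where
  lift : ∀ {a b c} → a / 2 ≡ b → b < c / 2 → a < c
  lift refl = m/2<n/2⇒m<n

nim-move : ∀ x y z → x ⊕ y ⊕ z ≢ 0 → NimMove x y z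
nim-move = halving-induction _ base step
  where
  base : ∀ y z → y ⊕ z ≢ 0 → NimMove 0 y z
  base y z ne with <-cmp y z
  ... | tri< y<z _ _ = inj₂ (inj₂ y<z)
  ... | tri≈ _ refl _ = contradiction (⊕-self y) ne
  ... | tri> _ _ z<y = inj₂ (inj₁ z<y)
  step : ∀ x .{{_ : NonZero x}} →
    (∀ y z → x / 2 ⊕ y ⊕ z ≢ 0 → NimMove (x / 2) y z) →
    ∀ y z → x ⊕ y ⊕ z ≢ 0 → NimMove x y z
  step x ih y z ne with x / 2 ⊕ y / 2 ⊕ z / 2 ≟ 0
  ... | yes e  = nim-move-lowest-bit x y z ne e
  ... | no  ne′ = nim-move-halves x y z (ih (y / 2) (z / 2) ne′)

infixl 6 _+⊕_
_+⊕_ : ℕ → ℕ → ℕ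
a +⊕ v = a + (a ⊕ v)

+⊕-split : ∀ a v {γ} → Bit γ →
  a +⊕ (γ + v * 2) ≡ (a % 2 + bitxor (a % 2) γ) + (a / 2 +⊕ v) * 2
+⊕-split a v {γ} bit = begin
  a + (a ⊕ (γ + v * 2))
    ≡⟨ cong₂ _+_ (m≡m%n+[m/n]*n a 2) (⊕-unfold a (γ + v * 2)) ⟩
  (a % 2 + a / 2 * 2) + (bitxor (a % 2) ((γ + v * 2) % 2) + (a / 2 ⊕ (γ + v * 2) / 2) * 2)
    ≡⟨ cong₂ (λ r q → (a % 2 + a / 2 * 2) + (bitxor (a % 2) r + (a / 2 ⊕ q) * 2))
         ([r+q*2]%2≡r v bit) ([r+q*2]/2≡q v bit) ⟩
  (a % 2 + a / 2 * 2) + (bitxor (a % 2) γ + (a / 2 ⊕ v) * 2)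
    ≡⟨ regroup (a % 2) (a / 2) (bitxor (a % 2) γ) (a / 2 ⊕ v) ⟩
  (a % 2 + bitxor (a % 2) γ) + (a / 2 +⊕ v) * 2
    ∎
  where
  open ≡-Reasoning
  regroup : ∀ r q s t → (r + q * 2) + (s + t * 2) ≡ (r + s) + (q + t) * 2
  regroup = solve-∀

+⊕-even : ∀ a v → a +⊕ v * 2 ≡ (a % 2 + (a / 2 +⊕ v)) * 2
+⊕-even a v = trans (+⊕-split a v (inj₁ refl)) (double (%2-bit a))
  where
  double : ∀ {r} → Bit r → (r + bitxor r 0) + (a / 2 +⊕ v) * 2 ≡ (r + (a / 2 +⊕ v)) * 2
  double (inj₁ refl) = refl
  double (inj₂ refl) = refl

+⊕-odd : ∀ a v → a +⊕ suc (v * 2) ≡ suc ((a / 2 +⊕ v) * 2)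
+⊕-odd a v = trans (+⊕-split a v (inj₂ refl)) (cong (_+ (a / 2 +⊕ v) * 2) (one (%2-bit a)))
  where
  one : ∀ {r} → Bit r → r + bitxor r 1 ≡ 1
  one (inj₁ refl) = refl
  one (inj₂ refl) = refl

m<n/2⇒1+m*2<n : ∀ {m n} → m < n / 2 → suc (m * 2) < n
m<n/2⇒1+m*2<n {m} {n} lt = ≤-trans (*-monoˡ-≤ 2 lt) (m/n*n≤m n 2)

even-or-odd : ∀ n → n ≡ n / 2 * 2 ⊎ n ≡ suc (n / 2 * 2)
even-or-odd n with %2-bit n
... | inj₁ n₀ = inj₁ (trans (m≡m%n+[m/n]*n n 2) (cong (_+ n / 2 * 2) n₀))
... | inj₂ n₀ = inj₂ (trans (m≡m%n+[m/n]*n n 2) (cong (_+ n / 2 * 2) n₀))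

module OddDivisor (K c : ℕ) (K≡ : K ≡ suc (c * 2)) where

  instance
    K-nonZero : NonZero K
    K-nonZero = ≢-nonZero λ K≡0 → 0≢1+n (trans (sym K≡0) K≡)

  even≢odd*K : ∀ n w → n * 2 ≢ suc (w * 2) * K
  even≢odd*K n w e = even≢odd n (c + w * K) (begin
    2 * n                   ≡⟨ *-comm 2 n ⟩
    n * 2                   ≡⟨ e ⟩
    suc (w * 2) * K         ≡⟨ cong (suc (w * 2) *_) K≡ ⟩
    suc (w * 2) * suc (c * 2) ≡⟨ odd*odd w c ⟩
    suc (2 * (c + w * suc (c * 2))) ≡⟨ cong (λ K → suc (2 * (c + w * K))) K≡ ⟨
    suc (2 * (c + w * K))   ∎)
    where
    open ≡-Reasoning
    odd*odd : ∀ w c → suc (w * 2) * suc (c * 2) ≡ suc (2 * (c + w * suc (c * 2)))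
    odd*odd = solve-∀

  half-quotient-lower : ∀ a v → v * K ≤ a / 2 +⊕ v → v * 2 * K ≤ a +⊕ v * 2
  half-quotient-lower a v le = begin
    v * 2 * K                 ≡⟨ *-comm-middle v 2 K ⟩
    v * K * 2                 ≤⟨ *-monoˡ-≤ 2 le ⟩
    (a / 2 +⊕ v) * 2          ≤⟨ *-monoˡ-≤ 2 (m≤n+m (a / 2 +⊕ v) (a % 2)) ⟩
    (a % 2 + (a / 2 +⊕ v)) * 2 ≡⟨ +⊕-even a v ⟨
    a +⊕ v * 2                ∎
    where
    open ≤-Reasoning
    *-comm-middle : ∀ m n o → m * n * o ≡ m * o * n
    *-comm-middle = solve-∀

  +⊕-even≤ : ∀ a v → a +⊕ v * 2 ≤ suc (a / 2 +⊕ v) * 2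
  +⊕-even≤ a v = ≤-trans (≤-reflexive (+⊕-even a v))
    (*-monoˡ-≤ 2 (+-monoˡ-≤ (a / 2 +⊕ v) (s≤s⁻¹ (m%n<n a 2))))

  quotient-double : ∀ a v → IsQuotient (a / 2 +⊕ v) K v →
    IsQuotient (a +⊕ v * 2) K (v * 2) ⊎ IsQuotient (a +⊕ suc (v * 2)) K (suc (v * 2))
  quotient-double a v (lo , hi) with a +⊕ v * 2 <? suc (v * 2) * K
  ... | yes even-hi = inj₁ (half-quotient-lower a v lo , even-hi)
  ... | no  even-hi̸ = inj₂ (odd-lo , odd-hi)
    where
    X = a / 2 +⊕ v
    odd-lo : suc (v * 2) * K ≤ a +⊕ suc (v * 2)
    odd-lo = subst (suc (v * 2) * K ≤_) (sym (+⊕-odd a v)) (s≤s⁻¹ (≤∧≢⇒<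
      (≤-trans (≮⇒≥ even-hi̸) (+⊕-even≤ a v))
      (λ e → even≢odd*K (suc X) v (sym e))))
    odd-hi : a +⊕ suc (v * 2) < suc (suc (v * 2)) * K
    odd-hi = subst₂ _≤_ (cong suc (sym (+⊕-odd a v))) (double-suc v K) (*-monoˡ-≤ 2 hi)
      where
      double-suc : ∀ v K → suc v * K * 2 ≡ suc (suc (v * 2)) * K
      double-suc = solve-∀

  quotient-at-odd : ∀ a v → v * K ≤ a / 2 +⊕ v → a +⊕ suc (v * 2) < suc (v * 2) * K →
    IsQuotient (a +⊕ v * 2) K (v * 2)
  quotient-at-odd a v lo odd-below = half-quotient-lower a v lo , ≤-<-trans (+⊕-even≤ a v)
    (≤∧≢⇒< (subst (_< suc (v * 2) * K) (+⊕-odd a v) odd-below)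
      (even≢odd*K (suc (a / 2 +⊕ v)) v))

  fixed-point-below : ∀ y a → a +⊕ y < y * K → ∃[ v ] v < y × IsQuotient (a +⊕ v) K v
  fixed-point-below = halving-induction _ (λ _ ()) step
    where
    step : ∀ y .{{_ : NonZero y}} →
      (∀ a → a +⊕ y / 2 < y / 2 * K → ∃[ v ] v < y / 2 × IsQuotient (a +⊕ v) K v) →
      ∀ a → a +⊕ y < y * K → ∃[ v ] v < y × IsQuotient (a +⊕ v) K v
    step y ih a below with a / 2 +⊕ y / 2 <? y / 2 * K
    ... | yes half-below with ih (a / 2) half-below
    ...   | v , v<y/2 , q with quotient-double a v q
    ...     | inj₁ q₀ = v * 2 , <-trans (n<1+n (v * 2)) (m<n/2⇒1+m*2<n v<y/2) , q₀
    ...     | inj₂ q₁ = suc (v * 2) , m<n/2⇒1+m*2<n v<y/2 , q₁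
    step y ih a below | no half-below̸ with even-or-odd y
    ... | inj₁ y≡even = contradiction (half-quotient-lower a (y / 2) lo)
                          (<⇒≱ (subst (λ y → a +⊕ y < y * K) y≡even below))
      where lo = ≮⇒≥ half-below̸
    ... | inj₂ y≡odd = y / 2 * 2 , subst (y / 2 * 2 <_) (sym y≡odd) (n<1+n (y / 2 * 2)) ,
                       quotient-at-odd a (y / 2) (≮⇒≥ half-below̸)
                         (subst (λ y → a +⊕ y < y * K) y≡odd below)

  fixed-quotient-below : ∀ a y → ¬ y ≤ (a +⊕ y) / K → ∃[ v ] v < y × (a +⊕ v) / K ≡ v
  fixed-quotient-below a y y≰
    with fixed-point-below y a (≰⇒> (λ le → y≰ (m*n≤o⇒m≤o/n le)))
  ... | v , v<y , q = v , v<y , IsQuotient⇒/≡ q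

k≡odd : ∀ m → k m ≡ suc (suc (m * 2) * 2)
k≡odd m = 3+4m≡odd m
  where
  3+4m≡odd : ∀ m → 3 + 4 * m ≡ suc (suc (m * 2) * 2)
  3+4m≡odd = solve-∀

f-monoʳ-≤ : ∀ m x {z w} → z ≤ w → f m x z ≤ f m x w
f-monoʳ-≤ m x z≤w = /-monoˡ-≤ (k m) (+-monoʳ-≤ x z≤w)

move-third : ∀ m x y z → y ≤ f m x z → x ⊕ y < z →
    (Σ ℕ λ w → w < z × y ≤ f m x w × x ⊕ y ⊕ w ≡ 0)
    ⊎ (Σ ℕ λ v → Σ ℕ λ w → v < y × w < z × v ≡ f m x w × x ⊕ v ⊕ w ≡ 0)
move-third m x y z y≤f xy<z with y ≤? f m x (x ⊕ y)
... | yes y≤f′ = inj₁ (x ⊕ y , xy<z , y≤f′ , ⊕-self (x ⊕ y))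
... | no  y≰f′ with OddDivisor.fixed-quotient-below (k m) (suc (m * 2)) (k≡odd m) x y y≰f′
...   | v , v<y , v≡ = inj₂ (v , x ⊕ v , v<y , w<z , sym v≡ , ⊕-self (x ⊕ v))
  where
  w<z : x ⊕ v < z
  w<z = ≰⇒> λ z≤w →
    <⇒≱ v<y (≤-trans y≤f (≤-trans (f-monoʳ-≤ m x z≤w) (≤-reflexive v≡)))

lemma2p9 : (m x y z : ℕ) → x ⊕ y ⊕ z ≢ 0 → y ≤ f m x z →
    (Σ ℕ λ u → u < x × u ⊕ y ⊕ z ≡ 0)
    ⊎ ((Σ ℕ λ u → Σ ℕ λ v → u < x × v < y × v ≡ f m u z × u ⊕ v ⊕ z ≡ 0)
    ⊎ ((Σ ℕ λ v → v < y × x ⊕ v ⊕ z ≡ 0)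
    ⊎ ((Σ ℕ λ w → w < z × y ≤ f m x w × x ⊕ y ⊕ w ≡ 0)
    ⊎ (Σ ℕ λ v → Σ ℕ λ w → v < y × w < z × v ≡ f m x w × x ⊕ v ⊕ w ≡ 0))))
lemma2p9 m x y z ne y≤f with nim-move x y z ne
... | inj₁ yz<x = inj₁ (y ⊕ z , yz<x , trans (⊕-rotate (y ⊕ z) y z) (⊕-self (y ⊕ z)))
... | inj₂ (inj₁ xz<y) =
  inj₂ (inj₂ (inj₁ (x ⊕ z , xz<y , trans (⊕-swapʳ x (x ⊕ z) z) (⊕-self (x ⊕ z)))))
... | inj₂ (inj₂ xy<z) = inj₂ (inj₂ (inj₂ (move-third m x y z y≤f xy<z)))
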